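{- Let $\langle\Sigma,T\rangle$ be a DB schema such that $T$ has a model completion $T^*$, and let $(\underline x,\underline a)$ be an artifact setting over an artifact extension $\Sigma^{ext}$ of $\Sigma$. For every extended state formula $\exists\underline e\,\phi(\underline e,\underline x,\underline a)$ there is a state formula equivalent to it in all $\Sigma^{ext}$-structures whose $\Sigma$-reduct is a model of $T^*$.
   Context: A DB signature $\Sigma$ is a finite multi-sorted signature with equality whose only non-logical symbols are unary function symbols and constants; a DB theory $T$ is a set of universal $\Sigma$-sentences. A model completion of $T$ is a $\Sigma$-theory $T^*\supseteq T$ with quantifier elimination such that every conjunction of literals satisfiable in a model of $T$ is satisfiable in a model of $T^*$. An artifact extension $\Sigma^{ext}$ adds new sorts (artifact sorts) to $\Sigma$, whose sorts are called basic sorts. An artifact setting $(\underline x,\underline a)$ consists of finitely many individual variables $\underline x$ and finitely many unary function variables $\underline a$, each with an artifact sort as source and a basic sort as target. A state formula is $\exists\underline e\,\phi(\underline e,\underline x,\underline a)$ with $\phi$ quantifier-free and all $\underline e$ of artifact sorts. An extended state formula is $\exists\underline e\,\phi(\underline e,\underline x,\underline a)$ with $\phi$ quantifier-free and $\underline e$ of basic or artifact sorts. -}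

module Defs where

open import Level using (0ℓ)
open import Data.Nat using (ℕ)
open import Data.Fin using (Fin)
open import Data.Sum using (_⊎_; inj₁; inj₂)
open import Data.Product using (Σ; _×_; _,_)
open import Data.Unit using (⊤)
open import Data.Empty using (⊥)
open import Data.List using (List; []; _∷_; _++_; map; foldr)
open import Data.List.Membership.Propositional using (_∈_)
open import Data.List.Relation.Unary.All as All using (All; []; _∷_)
open import Relation.Binary.PropositionalEquality using (_≡_)
open import Function.Bundles using (_⇔_)

record Lang : Set₁ where
  field
    Sort  : Set
    Fun   : Set
    Con   : Set
    dom   : Fun → Sort
    cod   : Fun → Sort
    csort : Con → Sort

module Syntax (L : Lang) where
  open Lang L

  Ctx : Set
  Ctx = List Sort

  data Term (Γ : Ctx) : Sort → Set where
    var : ∀ {s} → s ∈ Γ → Term Γ s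
    con : (c : Con) → Term Γ (csort c)
    app : (f : Fun) → Term Γ (dom f) → Term Γ (cod f)

  data Fm (Γ : Ctx) : Set where
    _≐_  : ∀ {s} → Term Γ s → Term Γ s → Fm Γ
    tt   : Fm Γ
    ff   : Fm Γ
    ¬'_  : Fm Γ → Fm Γ
    _∧'_ : Fm Γ → Fm Γ → Fm Γ
    _∨'_ : Fm Γ → Fm Γ → Fm Γ
    ∃'   : (s : Sort) → Fm (s ∷ Γ) → Fm Γ
    ∀'   : (s : Sort) → Fm (s ∷ Γ) → Fm Γ

  data IsQF {Γ : Ctx} : Fm Γ → Set where
    qf-eq  : ∀ {s} (t u : Term Γ s) → IsQF (t ≐ u)
    qf-tt  : IsQF tt
    qf-ff  : IsQF ff
    qf-not : ∀ {φ} → IsQF φ → IsQF (¬' φ)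
    qf-and : ∀ {φ ψ} → IsQF φ → IsQF ψ → IsQF (φ ∧' ψ)
    qf-or  : ∀ {φ ψ} → IsQF φ → IsQF ψ → IsQF (φ ∨' ψ)

  data IsUniversal : {Γ : Ctx} → Fm Γ → Set where
    univ-qf  : ∀ {Γ} {φ : Fm Γ} → IsQF φ → IsUniversal φ
    univ-all : ∀ {Γ s} {φ : Fm (s ∷ Γ)} → IsUniversal φ → IsUniversal (∀' s φ)

  data Literal (Γ : Ctx) : Set where
    pos : ∀ {s} → Term Γ s → Term Γ s → Literal Γ
    neg : ∀ {s} → Term Γ s → Term Γ s → Literal Γ

  litFm : ∀ {Γ} → Literal Γ → Fm Γ
  litFm (pos t u) = t ≐ u
  litFm (neg t u) = ¬' (t ≐ u)

  conj : ∀ {Γ} → List (Literal Γ) → Fm Γ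
  conj = foldr (λ l φ → litFm l ∧' φ) tt

  exs : ∀ {Γ} (E : Ctx) → Fm (E ++ Γ) → Fm Γ
  exs []      φ = φ
  exs (s ∷ E) φ = exs E (∃' s φ)

  Sentence : Set
  Sentence = Fm []

  Theory : Set₁
  Theory = Sentence → Set

  record Structure : Set₁ where
    field
      carrier : Sort → Set
      fun     : (f : Fun) → carrier (dom f) → carrier (cod f)
      const   : (c : Con) → carrier (csort c)

  module _ (M : Structure) where
    open Structure M

    Env : Ctx → Set
    Env Γ = All carrier Γ

    evalT : ∀ {Γ s} → Term Γ s → Env Γ → carrier s
    evalT (var x)   ρ = All.lookup ρ x
    evalT (con c)   ρ = const c
    evalT (app f t) ρ = fun f (evalT t ρ)

    sat : ∀ {Γ} → Fm Γ → Env Γ → Set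
    sat (t ≐ u)   ρ = evalT t ρ ≡ evalT u ρ
    sat tt        ρ = ⊤
    sat ff        ρ = ⊥
    sat (¬' φ)    ρ = sat φ ρ → ⊥
    sat (φ ∧' ψ)  ρ = sat φ ρ × sat ψ ρ
    sat (φ ∨' ψ)  ρ = sat φ ρ ⊎ sat ψ ρ
    sat (∃' s φ)  ρ = Σ (carrier s) λ a → sat φ (a ∷ ρ)
    sat (∀' s φ)  ρ = (a : carrier s) → sat φ (a ∷ ρ)

  _⊨_ : Structure → Theory → Set
  M ⊨ T = (φ : Sentence) → T φ → sat M φ []

  HasQE : Theory → Set₁
  HasQE T = ∀ {Γ} (φ : Fm Γ) →
    Σ (Fm Γ) λ ψ → IsQF ψ ×
      ((M : Structure) → M ⊨ T → (ρ : Env M Γ) → sat M φ ρ ⇔ sat M ψ ρ)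

  SatIn : Theory → ∀ {Γ} → List (Literal Γ) → Set₁
  SatIn T {Γ} ls = Σ Structure λ M → M ⊨ T × Σ (Env M Γ) λ ρ → sat M (conj ls) ρ

  record IsModelCompletion (T T* : Theory) : Set₁ where
    field
      extends : (φ : Sentence) → T φ → T* φ
      qe      : HasQE T*
      litsat  : ∀ {Γ} (ls : List (Literal Γ)) → SatIn T ls → SatIn T* ls

open Syntax public

record DBSig : Set where
  field
    nSort : ℕ
    nFun  : ℕ
    nCon  : ℕ
    fdom  : Fin nFun → Fin nSort
    fcod  : Fin nFun → Fin nSort
    csrt  : Fin nCon → Fin nSort

sigLang : DBSig → Lang
sigLang Sg = record
  { Sort = Fin nSort ; Fun = Fin nFun ; Con = Fin nCon
  ; dom = fdom ; cod = fcod ; csort = csrt }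
  where open DBSig Sg

IsDBTheory : (Sg : DBSig) → Theory (sigLang Sg) → Set
IsDBTheory Sg T = (φ : Sentence (sigLang Sg)) → T φ → IsUniversal (sigLang Sg) φ

data ExtSort (nS nA : ℕ) : Set where
  basic : Fin nS → ExtSort nS nA
  art   : Fin nA → ExtSort nS nA

-- An artifact setting (x, a) over the artifact extension of Sg with nA
-- artifact sorts: individual variables x (listed by their basic sorts)
-- and nAF unary function variables a_i : art (asrc i) → basic (atgt i).
record ArtSetting (Sg : DBSig) (nA : ℕ) : Set where
  field
    xsorts : List (Fin (DBSig.nSort Sg))
    nAF    : ℕ
    asrc   : Fin nAF → Fin nA
    atgt   : Fin nAF → Fin (DBSig.nSort Sg)

module _ {Sg : DBSig} {nA : ℕ} (S : ArtSetting Sg nA) where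
  open DBSig Sg
  open ArtSetting S

  -- the language of Σ^ext enriched with the function variables a
  -- (treated as extra unary function symbols; x are free variables)
  extLang : Lang
  extLang = record
    { Sort  = ExtSort nSort nA
    ; Fun   = Fin nFun ⊎ Fin nAF
    ; Con   = Fin nCon
    ; dom   = λ { (inj₁ f) → basic (fdom f) ; (inj₂ i) → art (asrc i) }
    ; cod   = λ { (inj₁ f) → basic (fcod f) ; (inj₂ i) → basic (atgt i) }
    ; csort = λ c → basic (csrt c) }

  xCtx : Ctx extLang
  xCtx = map basic xsorts

  reduct : Structure extLang → Structure (sigLang Sg)
  reduct M = record
    { carrier = λ s → carrier (basic s)
    ; fun     = λ f → fun (inj₁ f)
    ; const   = const }
    where open Structure M

  record ExtStateFm : Set where
    field
      evars : List (ExtSort nSort nA)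
      body  : Fm extLang (evars ++ xCtx)
      bodyQF : IsQF extLang body

  record StateFm : Set where
    field
      evars : List (Fin nA)
      body  : Fm extLang (map art evars ++ xCtx)
      bodyQF : IsQF extLang body

  extStateFm : ExtStateFm → Fm extLang xCtx
  extStateFm φ = exs extLang (ExtStateFm.evars φ) (ExtStateFm.body φ)

  stateFm : StateFm → Fm extLang xCtx
  stateFm ψ = exs extLang (map art (StateFm.evars ψ)) (StateFm.body ψ)

module Submission where

-- A single
-- existential ∃x φ over a basic-sorted variable x, with φ quantifier-free,
-- can be eliminated: artifact-sorted terms are variables (no symbol has an
-- artifact target sort), so every atom of φ is either an artifact equality
-- not mentioning x, or an equality of basic terms built by Σ-symbols from x
-- and "leaves" (basic variables and applications a_i(e)).  Replacing the
-- leaves by fresh variables, φ becomes a disjunction of clauses A ∧ B(x),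
-- with A quantifier free and x-free and B a Σ-formula (pushing negations
-- inward uses excluded middle); then ∃x ⋁(A ∧ B) ↔ ⋁(A ∧ ∃x B), each ∃x B
-- is eliminated in T*, and the leaves are substituted back.
-- Finally an extended state formula is processed
-- quantifier by quantifier from the inside: an artifact quantifier joins the
-- artifact block, a basic one is moved inside that block and eliminated.

open import Defs
open import Level using (0ℓ)
open import Data.Nat using (ℕ)
open import Data.Fin using (Fin)
open import Data.Product using (Σ; _×_; _,_; proj₁; proj₂)
open import Data.Product.Function.NonDependent.Propositional using (_×-cong_)
open import Data.Sum using (_⊎_; inj₁; inj₂; [_,_])
open import Data.Sum.Function.Propositional using (_⊎-cong_)
open import Data.Unit using (tt)
open import Data.Empty using (⊥-elim)
open import Data.List using (List; []; _∷_; _++_; map; cartesianProductWith)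
open import Data.List.Membership.Propositional using (_∈_)
open import Data.List.Relation.Binary.Subset.Propositional using (_⊆_)
open import Data.List.Relation.Binary.Subset.Propositional.Properties
  using (xs⊆xs++ys; xs⊆ys++xs)
open import Data.List.Relation.Unary.Any as Any using (Any; here; there)
open import Data.List.Relation.Unary.Any.Properties
  using (++↔; map↔; singleton⁻; cartesianProductWith⁺; cartesianProductWith⁻)
open import Data.List.Relation.Unary.All as All using (All; []; _∷_)
open import Data.List.Relation.Unary.All.Properties using () renaming (++⁺ to _++ᴱ_; map⁺ to All-map⁺)
open import Relation.Binary.PropositionalEquality using (_≡_; refl; sym; trans; cong; subst)
open import Relation.Nullary using (¬_; yes; no)
open import Function.Bundles using (_⇔_; mk⇔; Equivalence)
open import Function.Construct.Identity using (⇔-id)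
open import Function.Construct.Symmetry using (⇔-sym)
open import Function.Construct.Composition using () renaming (equivalence to ⇔-trans)
open import Function.Properties.Inverse using (↔⇒⇔)
open import Function.Related.TypeIsomorphisms using (¬-cong-⇔; ∃∃↔∃∃)
open import Function.Related.Propositional using (equivalence; module EquationalReasoning)
open import Axiom.ExcludedMiddle using (ExcludedMiddle)
open import Axiom.DoubleNegationElimination using (em⇒dne)

open EquationalReasoning {k = equivalence}

≡-cong⇔ : {A : Set} {x x′ y y′ : A} → x ≡ x′ → y ≡ y′ → (x ≡ y) ⇔ (x′ ≡ y′)
≡-cong⇔ refl refl = ⇔-id _

∃-cong : {A : Set} {P Q : A → Set} → (∀ a → P a ⇔ Q a) → Σ A P ⇔ Σ A Q
∃-cong eq = mk⇔ (λ (a , p) → a , Equivalence.to (eq a) p)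
                (λ (a , q) → a , Equivalence.from (eq a) q)

∀-cong : {A : Set} {P Q : A → Set} → (∀ a → P a ⇔ Q a) → ((a : A) → P a) ⇔ ((a : A) → Q a)
∀-cong eq = mk⇔ (λ p a → Equivalence.to (eq a) (p a)) (λ q a → Equivalence.from (eq a) (q a))

Any-cong : {A : Set} {P Q : A → Set} {xs : List A} → (∀ x → P x ⇔ Q x) → Any P xs ⇔ Any Q xs
Any-cong eq = mk⇔ (Any.map (Equivalence.to (eq _))) (Any.map (Equivalence.from (eq _)))

∃-Any : {A B : Set} {P : A → B → Set} (xs : List B) →
        Σ A (λ a → Any (P a) xs) ⇔ Any (λ x → Σ A λ a → P a x) xs
∃-Any {A} {P = P} xs = mk⇔ (λ (a , p) → Any.map (a ,_) p) pull
  where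
  pull : ∀ {ys} → Any (λ x → Σ A λ a → P a x) ys → Σ A (λ a → Any (P a) ys)
  pull (here (a , p)) = a , here p
  pull (there q)      = let (a , p) = pull q in a , there p

×-∃⇔∃-× : {A C : Set} {B : C → Set} → (A × Σ C B) ⇔ Σ C (λ c → A × B c)
×-∃⇔∃-× = mk⇔ (λ (x , c , y) → c , x , y) (λ (c , x , y) → x , c , y)

¬⊎⇔¬×¬ : {P Q : Set} → (¬ (P ⊎ Q)) ⇔ (¬ P × ¬ Q)
¬⊎⇔¬×¬ = mk⇔ (λ ¬pq → (λ p → ¬pq (inj₁ p)) , (λ q → ¬pq (inj₂ q))) (λ (¬p , ¬q) → [ ¬p , ¬q ])

¬×⇔¬⊎¬ : ExcludedMiddle 0ℓ → {P Q : Set} → (¬ (P × Q)) ⇔ (¬ P ⊎ ¬ Q)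
¬×⇔¬⊎¬ em {P} {Q} = mk⇔ split (λ { (inj₁ ¬p) (p , _) → ¬p p ; (inj₂ ¬q) (_ , q) → ¬q q })
  where
  split : ¬ (P × Q) → ¬ P ⊎ ¬ Q
  split ¬pq with em {P}
  ... | yes p = inj₂ (λ q → ¬pq (p , q))
  ... | no ¬p = inj₁ ¬p

⊆-left : {A : Set} {xs ys zs : List A} → xs ++ ys ⊆ zs → xs ⊆ zs
⊆-left {xs = xs} {ys} sub p = sub (xs⊆xs++ys xs ys p)

⊆-right : {A : Set} {xs ys zs : List A} → xs ++ ys ⊆ zs → ys ⊆ zs
⊆-right {xs = xs} {ys} sub p = sub (xs⊆ys++xs ys xs p)

module FirstOrder (L : Lang) where

  extend : ∀ {Γ Δ : Ctx L} {s} → Γ ⊆ Δ → (s ∷ Γ) ⊆ (s ∷ Δ)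
  extend r (here p)  = here p
  extend r (there x) = there (r x)

  renameT : ∀ {Γ Δ s} → Γ ⊆ Δ → Term L Γ s → Term L Δ s
  renameT r (var x)   = var (r x)
  renameT r (con c)   = con c
  renameT r (app f t) = app f (renameT r t)

  renameF : ∀ {Γ Δ} → Γ ⊆ Δ → Fm L Γ → Fm L Δ
  renameF r (t ≐ u)  = renameT r t ≐ renameT r u
  renameF r tt       = tt
  renameF r ff       = ff
  renameF r (¬' φ)   = ¬' renameF r φ
  renameF r (φ ∧' ψ) = renameF r φ ∧' renameF r ψ
  renameF r (φ ∨' ψ) = renameF r φ ∨' renameF r ψ
  renameF r (∃' s φ) = ∃' s (renameF (extend r) φ)
  renameF r (∀' s φ) = ∀' s (renameF (extend r) φ)

  renameF-QF : ∀ {Γ Δ} (r : Γ ⊆ Δ) {φ : Fm L Γ} → IsQF L φ → IsQF L (renameF r φ)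
  renameF-QF r (qf-eq t u)   = qf-eq _ _
  renameF-QF r qf-tt         = qf-tt
  renameF-QF r qf-ff         = qf-ff
  renameF-QF r (qf-not q)    = qf-not (renameF-QF r q)
  renameF-QF r (qf-and q q′) = qf-and (renameF-QF r q) (renameF-QF r q′)
  renameF-QF r (qf-or q q′)  = qf-or (renameF-QF r q) (renameF-QF r q′)

  -- The inclusion that moves the variable just behind a block E to its front;
  -- it lets ∃σ be pushed inside ∃E.
  moveFront : ∀ (E : Ctx L) {σ Δ} → (E ++ σ ∷ Δ) ⊆ (σ ∷ E ++ Δ)
  moveFront []      x         = x
  moveFront (_ ∷ E) (here p)  = there (here p)
  moveFront (_ ∷ E) (there x) = extend there (moveFront E x)

  ⋁ : ∀ {Γ} → List (Fm L Γ) → Fm L Γ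
  ⋁ []       = ff
  ⋁ (φ ∷ φs) = φ ∨' ⋁ φs

  ⋁-QF : ∀ {Γ} {φs : List (Fm L Γ)} → All (IsQF L) φs → IsQF L (⋁ φs)
  ⋁-QF []       = qf-ff
  ⋁-QF (q ∷ qs) = qf-or q (⋁-QF qs)

  module _ (M : Structure L) where
    open Structure M

    Agrees : ∀ {Γ Δ} → Γ ⊆ Δ → Env L M Γ → Env L M Δ → Set
    Agrees {Γ} r ρ ρ′ = ∀ {s} (x : s ∈ Γ) → All.lookup ρ′ (r x) ≡ All.lookup ρ x

    extend-agrees : ∀ {Γ Δ s} {r : Γ ⊆ Δ} {ρ ρ′} (a : carrier s) →
                    Agrees r ρ ρ′ → Agrees (extend r) (a ∷ ρ) (a ∷ ρ′)
    extend-agrees a ag (here refl) = refl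
    extend-agrees a ag (there x)   = ag x

    renameT-eval : ∀ {Γ Δ s} {r : Γ ⊆ Δ} {ρ ρ′} → Agrees r ρ ρ′ → (t : Term L Γ s) →
                   evalT L M (renameT r t) ρ′ ≡ evalT L M t ρ
    renameT-eval ag (var x)   = ag x
    renameT-eval ag (con c)   = refl
    renameT-eval ag (app f t) = cong (fun f) (renameT-eval ag t)

    renameF-sat : ∀ {Γ Δ} {r : Γ ⊆ Δ} {ρ ρ′} → Agrees r ρ ρ′ → (φ : Fm L Γ) →
                  sat L M (renameF r φ) ρ′ ⇔ sat L M φ ρ
    renameF-sat ag (t ≐ u)  = ≡-cong⇔ (renameT-eval ag t) (renameT-eval ag u)
    renameF-sat ag tt       = ⇔-id _
    renameF-sat ag ff       = ⇔-id _
    renameF-sat ag (¬' φ)   = ¬-cong-⇔ (renameF-sat ag φ)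
    renameF-sat ag (φ ∧' ψ) = renameF-sat ag φ ×-cong renameF-sat ag ψ
    renameF-sat ag (φ ∨' ψ) = renameF-sat ag φ ⊎-cong renameF-sat ag ψ
    renameF-sat ag (∃' s φ) = ∃-cong λ a → renameF-sat (extend-agrees a ag) φ
    renameF-sat ag (∀' s φ) = ∀-cong λ a → renameF-sat (extend-agrees a ag) φ

    exs-sat : ∀ {Γ} (E : Ctx L) (φ : Fm L (E ++ Γ)) (ρ : Env L M Γ) →
              sat L M (exs L E φ) ρ ⇔ Σ (Env L M E) λ τ → sat L M φ (τ ++ᴱ ρ)
    exs-sat []      φ ρ = mk⇔ ([] ,_) (λ { ([] , φτ) → φτ })
    exs-sat (s ∷ E) φ ρ = ⇔-trans (exs-sat E (∃' s φ) ρ)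
      (mk⇔ (λ (τ , a , φτ) → (a ∷ τ) , φτ) (λ { ((a ∷ τ) , φτ) → τ , a , φτ }))

    exs-cong : ∀ {Γ} (E : Ctx L) {φ ψ : Fm L (E ++ Γ)} →
               (∀ ρ → sat L M φ ρ ⇔ sat L M ψ ρ) →
               ∀ ρ → sat L M (exs L E φ) ρ ⇔ sat L M (exs L E ψ) ρ
    exs-cong []      eq = eq
    exs-cong (s ∷ E) eq = exs-cong E (λ ρ → ∃-cong λ a → eq (a ∷ ρ))

    moveFront-agrees : ∀ (E : Ctx L) {σ Δ} (τ : Env L M E) (a : carrier σ) (ρ : Env L M Δ) →
                       Agrees (moveFront E) (τ ++ᴱ (a ∷ ρ)) (a ∷ (τ ++ᴱ ρ))
    moveFront-agrees []      []      a ρ x           = refl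
    moveFront-agrees (_ ∷ E) (b ∷ τ) a ρ (here refl) = refl
    moveFront-agrees (_ ∷ E) (b ∷ τ) a ρ (there x)   =
      trans (extend-agrees a (λ _ → refl) (moveFront E x)) (moveFront-agrees E τ a ρ x)

    ∃-over-exs : ∀ (E : Ctx L) {σ Δ} (φ : Fm L (E ++ σ ∷ Δ)) (ρ : Env L M Δ) →
                 sat L M (∃' σ (exs L E φ)) ρ ⇔
                 sat L M (exs L E (∃' σ (renameF (moveFront E) φ))) ρ
    ∃-over-exs E {σ} φ ρ = begin
      Σ (carrier σ) (λ a → sat L M (exs L E φ) (a ∷ ρ))
        ∼⟨ ∃-cong (λ a → exs-sat E φ (a ∷ ρ)) ⟩
      Σ (carrier σ) (λ a → Σ (Env L M E) λ τ → sat L M φ (τ ++ᴱ (a ∷ ρ)))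
        ↔⟨ ∃∃↔∃∃ _ ⟩
      Σ (Env L M E) (λ τ → Σ (carrier σ) λ a → sat L M φ (τ ++ᴱ (a ∷ ρ)))
        ∼⟨ ∃-cong (λ τ → ∃-cong λ a → ⇔-sym (renameF-sat (moveFront-agrees E τ a ρ) φ)) ⟩
      Σ (Env L M E) (λ τ → sat L M (∃' σ (renameF (moveFront E) φ)) (τ ++ᴱ ρ))
        ∼⟨ ⇔-sym (exs-sat E _ ρ) ⟩
      sat L M (exs L E (∃' σ (renameF (moveFront E) φ))) ρ ∎

    ⋁-sat : ∀ {Γ} (φs : List (Fm L Γ)) (ρ : Env L M Γ) →
            sat L M (⋁ φs) ρ ⇔ Any (λ φ → sat L M φ ρ) φs
    ⋁-sat []       ρ = mk⇔ (λ ()) (λ ())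
    ⋁-sat (φ ∷ φs) ρ = mk⇔ [ here , (λ p → there (to p)) ]
                           (λ { (here p) → inj₁ p ; (there p) → inj₂ (from p) })
      where open Equivalence (⋁-sat φs ρ)

module ArtifactQE (em : ExcludedMiddle 0ℓ) {Sg : DBSig} (T* : Theory (sigLang Sg))
                  (qe : HasQE (sigLang Sg) T*) {nA : ℕ} (S : ArtSetting Sg nA) where
  open DBSig Sg
  open ArtSetting S

  LE : Lang
  LE = extLang S

  LS : Lang
  LS = sigLang Sg

  open FirstOrder LE

  _≋_ : ∀ {Δ} → Fm LE Δ → Fm LE Δ → Set₁
  φ ≋ ψ = (M : Structure LE) → _⊨_ LS (reduct S M) T* →
          ∀ ρ → sat LE M φ ρ ⇔ sat LE M ψ ρ

  module Elimination (Γ : Ctx LE) (s : Fin nSort) where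

    -- Leaves: basic-sorted terms over Γ, abstracted to Σ-variables.
    Leaf : Set
    Leaf = Σ (Fin nSort) λ t → Term LE Γ (basic t)

    leafSorts : List Leaf → Ctx LS
    leafSorts = map proj₁

    leafVar : ∀ {W : List Leaf} {ℓ} → ℓ ∈ W → proj₁ ℓ ∈ leafSorts W
    leafVar (here refl) = here refl
    leafVar (there p)   = there (leafVar p)

    leafTerm : ∀ (W : List Leaf) {t} → t ∈ leafSorts W → Term LE Γ (basic t)
    leafTerm ((_ , u) ∷ W) (here refl) = u
    leafTerm (_ ∷ W)       (there p)   = leafTerm W p

    -- Artifact-sorted terms are variables of Γ: no symbol has an artifact
    -- target sort, and the eliminated variable is basic.
    artVar′ : ∀ {σ} → Term LE (basic s ∷ Γ) σ → (k : Fin nA) → σ ≡ art k → art k ∈ Γ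
    artVar′ (var (here refl)) k ()
    artVar′ (var (there x))   k refl = x
    artVar′ (con c)           k ()
    artVar′ (app (inj₁ f) u)  k ()
    artVar′ (app (inj₂ i) u)  k ()

    artVar : ∀ {k} → Term LE (basic s ∷ Γ) (art k) → art k ∈ Γ
    artVar u = artVar′ u _ refl

    varLeaves : ∀ {σ} → σ ∈ (basic s ∷ Γ) → List Leaf
    varLeaves {basic t} (here refl) = []
    varLeaves {basic t} (there x)   = (t , var x) ∷ []
    varLeaves {art k}   _           = []

    termLeaves : ∀ {σ} → Term LE (basic s ∷ Γ) σ → List Leaf
    termLeaves (var x)          = varLeaves x
    termLeaves (con c)          = []
    termLeaves (app (inj₁ f) u) = termLeaves u
    termLeaves (app (inj₂ i) u) = (atgt i , app (inj₂ i) (var (artVar u))) ∷ []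

    fmLeaves : ∀ {φ : Fm LE (basic s ∷ Γ)} → IsQF LE φ → List Leaf
    fmLeaves (qf-eq u v)   = termLeaves u ++ termLeaves v
    fmLeaves qf-tt         = []
    fmLeaves qf-ff         = []
    fmLeaves (qf-not q)    = fmLeaves q
    fmLeaves (qf-and q q′) = fmLeaves q ++ fmLeaves q′
    fmLeaves (qf-or q q′)  = fmLeaves q ++ fmLeaves q′

    -- What a term over (x ∷ Γ) becomes once its leaves are abstracted: a
    -- Σ-term over x and the leaves (basic sorts), or a variable of Γ
    -- (artifact sorts).
    Pure : List Leaf → ExtSort nSort nA → Set
    Pure W (basic t) = Term LS (s ∷ leafSorts W) t
    Pure W (art k)   = art k ∈ Γ

    purifyVar : ∀ {σ} (x : σ ∈ (basic s ∷ Γ)) (W : List Leaf) → varLeaves x ⊆ W → Pure W σ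
    purifyVar {basic t} (here refl) W sub = var (here refl)
    purifyVar {basic t} (there x)   W sub = var (there (leafVar (sub (here refl))))
    purifyVar {art k}   (there x)   W sub = x

    purify : ∀ {σ} (u : Term LE (basic s ∷ Γ) σ) (W : List Leaf) → termLeaves u ⊆ W → Pure W σ
    purify (var x)          W sub = purifyVar x W sub
    purify (con c)          W sub = con c
    purify (app (inj₁ f) u) W sub = app f (purify u W sub)
    purify (app (inj₂ i) u) W sub = var (there (leafVar (sub (here refl))))

    -- A separated clause: a quantifier-free condition A on Γ alone, and a
    -- Σ-formula B about x and the leaves.  Lists of clauses are disjunctions.
    Clause : List Leaf → Set
    Clause W = Σ (Fm LE Γ) (IsQF LE) × Fm LS (s ∷ leafSorts W)

    pureClause : ∀ {W} → Fm LS (s ∷ leafSorts W) → Clause W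
    pureClause B = (tt , qf-tt) , B

    artClause : ∀ {W} → Σ (Fm LE Γ) (IsQF LE) → Clause W
    artClause A = A , tt

    _∧ᶜ_ : ∀ {W} → Clause W → Clause W → Clause W
    ((A , qA) , B) ∧ᶜ ((A′ , qA′) , B′) = (A ∧' A′ , qf-and qA qA′) , (B ∧' B′)

    -- the conjunction of two disjunctions of clauses, distributed out
    _⋀_ : ∀ {W} → List (Clause W) → List (Clause W) → List (Clause W)
    _⋀_ = cartesianProductWith _∧ᶜ_

    -- Separated disjunctive normal forms of φ and of ¬φ.
    dnf⁺ dnf⁻ : ∀ {φ} (q : IsQF LE φ) (W : List Leaf) → fmLeaves q ⊆ W → List (Clause W)
    dnf⁺ (qf-eq {basic t} u v) W sub =
      pureClause (purify u W (⊆-left sub) ≐ purify v W (⊆-right sub)) ∷ []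
    dnf⁺ (qf-eq {art k} u v)   W sub = artClause (var (artVar u) ≐ var (artVar v) , qf-eq _ _) ∷ []
    dnf⁺ qf-tt                 W sub = pureClause tt ∷ []
    dnf⁺ qf-ff                 W sub = []
    dnf⁺ (qf-not q)            W sub = dnf⁻ q W sub
    dnf⁺ (qf-and q q′)         W sub = dnf⁺ q W (⊆-left sub) ⋀ dnf⁺ q′ W (⊆-right sub)
    dnf⁺ (qf-or q q′)          W sub = dnf⁺ q W (⊆-left sub) ++ dnf⁺ q′ W (⊆-right sub)
    dnf⁻ (qf-eq {basic t} u v) W sub =
      pureClause (¬' (purify u W (⊆-left sub) ≐ purify v W (⊆-right sub))) ∷ []
    dnf⁻ (qf-eq {art k} u v)   W sub =
      artClause (¬' (var (artVar u) ≐ var (artVar v)) , qf-not (qf-eq _ _)) ∷ []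
    dnf⁻ qf-tt                 W sub = []
    dnf⁻ qf-ff                 W sub = pureClause tt ∷ []
    dnf⁻ (qf-not q)            W sub = dnf⁺ q W sub
    dnf⁻ (qf-and q q′)         W sub = dnf⁻ q W (⊆-left sub) ++ dnf⁻ q′ W (⊆-right sub)
    dnf⁻ (qf-or q q′)          W sub = dnf⁻ q W (⊆-left sub) ⋀ dnf⁻ q′ W (⊆-right sub)

    unpurifyT : ∀ (W : List Leaf) {t} → Term LS (leafSorts W) t → Term LE Γ (basic t)
    unpurifyT W (var p)   = leafTerm W p
    unpurifyT W (con c)   = con c
    unpurifyT W (app f τ) = app (inj₁ f) (unpurifyT W τ)

    unpurifyF : ∀ (W : List Leaf) {θ : Fm LS (leafSorts W)} → IsQF LS θ → Fm LE Γ
    unpurifyF W (qf-eq u v)   = unpurifyT W u ≐ unpurifyT W v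
    unpurifyF W qf-tt         = tt
    unpurifyF W qf-ff         = ff
    unpurifyF W (qf-not q)    = ¬' unpurifyF W q
    unpurifyF W (qf-and q q′) = unpurifyF W q ∧' unpurifyF W q′
    unpurifyF W (qf-or q q′)  = unpurifyF W q ∨' unpurifyF W q′

    unpurifyF-QF : ∀ (W : List Leaf) {θ : Fm LS (leafSorts W)} (q : IsQF LS θ) → IsQF LE (unpurifyF W q)
    unpurifyF-QF W (qf-eq u v)   = qf-eq _ _
    unpurifyF-QF W qf-tt         = qf-tt
    unpurifyF-QF W qf-ff         = qf-ff
    unpurifyF-QF W (qf-not q)    = qf-not (unpurifyF-QF W q)
    unpurifyF-QF W (qf-and q q′) = qf-and (unpurifyF-QF W q) (unpurifyF-QF W q′)
    unpurifyF-QF W (qf-or q q′)  = qf-or (unpurifyF-QF W q) (unpurifyF-QF W q′)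

    solvedQE : ∀ (W : List Leaf) → Fm LS (s ∷ leafSorts W) → Σ (Fm LS (leafSorts W)) (IsQF LS)
    solvedQE W B = let (θ , qθ , _) = qe (∃' s B) in θ , qθ

    solved : ∀ (W : List Leaf) → Clause W → Fm LE Γ
    solved W ((A , _) , B) = A ∧' unpurifyF W (proj₂ (solvedQE W B))

    solved-QF : ∀ (W : List Leaf) (c : Clause W) → IsQF LE (solved W c)
    solved-QF W ((_ , qA) , B) = qf-and qA (unpurifyF-QF W (proj₂ (solvedQE W B)))

    eliminated : ∀ (W : List Leaf) → List (Clause W) → Fm LE Γ
    eliminated W cs = ⋁ (map (solved W) cs)

    eliminated-QF : ∀ (W : List Leaf) (cs : List (Clause W)) → IsQF LE (eliminated W cs)
    eliminated-QF W cs = ⋁-QF (All-map⁺ (All.universal (solved-QF W) cs))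

    module AtStructure (M : Structure LE) (γ : Env LE M Γ) where
      open Structure M

      R : Structure LS
      R = reduct S M

      leafValues : (W : List Leaf) → Env LS R (leafSorts W)
      leafValues []            = []
      leafValues ((_ , u) ∷ W) = evalT LE M u γ ∷ leafValues W

      leafValues-leafVar : ∀ {W : List Leaf} {ℓ} (p : ℓ ∈ W) →
                           All.lookup (leafValues W) (leafVar p) ≡ evalT LE M (proj₂ ℓ) γ
      leafValues-leafVar (here refl) = refl
      leafValues-leafVar (there p)   = leafValues-leafVar p

      leafValues-leafTerm : ∀ (W : List Leaf) {t} (p : t ∈ leafSorts W) →
                            All.lookup (leafValues W) p ≡ evalT LE M (leafTerm W p) γ
      leafValues-leafTerm (_ ∷ W) (here refl) = refl
      leafValues-leafTerm (_ ∷ W) (there p)   = leafValues-leafTerm W p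

      unpurifyT-eval : ∀ (W : List Leaf) {t} (τ : Term LS (leafSorts W) t) →
                       evalT LE M (unpurifyT W τ) γ ≡ evalT LS R τ (leafValues W)
      unpurifyT-eval W (var p)   = sym (leafValues-leafTerm W p)
      unpurifyT-eval W (con c)   = refl
      unpurifyT-eval W (app f τ) = cong (fun (inj₁ f)) (unpurifyT-eval W τ)

      unpurifyF-sat : ∀ (W : List Leaf) {θ : Fm LS (leafSorts W)} (q : IsQF LS θ) →
                      sat LE M (unpurifyF W q) γ ⇔ sat LS R θ (leafValues W)
      unpurifyF-sat W (qf-eq u v)   = ≡-cong⇔ (unpurifyT-eval W u) (unpurifyT-eval W v)
      unpurifyF-sat W qf-tt         = ⇔-id _
      unpurifyF-sat W qf-ff         = ⇔-id _
      unpurifyF-sat W (qf-not q)    = ¬-cong-⇔ (unpurifyF-sat W q)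
      unpurifyF-sat W (qf-and q q′) = unpurifyF-sat W q ×-cong unpurifyF-sat W q′
      unpurifyF-sat W (qf-or q q′)  = unpurifyF-sat W q ⊎-cong unpurifyF-sat W q′

      module AtValue (a : carrier (basic s)) where

        Denotes : (W : List Leaf) (σ : ExtSort nSort nA) → Pure W σ → carrier σ → Set
        Denotes W (basic t) τ v = evalT LS R τ (a ∷ leafValues W) ≡ v
        Denotes W (art k)   x v = All.lookup γ x ≡ v

        artVar′-eval : ∀ {σ} (u : Term LE (basic s ∷ Γ) σ) k (e : σ ≡ art k) →
                       All.lookup γ (artVar′ u k e) ≡ subst carrier e (evalT LE M u (a ∷ γ))
        artVar′-eval (var (here refl)) k ()
        artVar′-eval (var (there x))   k refl = refl
        artVar′-eval (con c)           k ()
        artVar′-eval (app (inj₁ f) u)  k ()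
        artVar′-eval (app (inj₂ i) u)  k ()

        artVar-eval : ∀ {k} (u : Term LE (basic s ∷ Γ) (art k)) →
                      All.lookup γ (artVar u) ≡ evalT LE M u (a ∷ γ)
        artVar-eval u = artVar′-eval u _ refl

        purifyVar-correct : ∀ {σ} (x : σ ∈ (basic s ∷ Γ)) W (sub : varLeaves x ⊆ W) →
                            Denotes W σ (purifyVar x W sub) (All.lookup (a ∷ γ) x)
        purifyVar-correct {basic t} (here refl) W sub = refl
        purifyVar-correct {basic t} (there x)   W sub = leafValues-leafVar (sub (here refl))
        purifyVar-correct {art k}   (there x)   W sub = refl

        purify-correct : ∀ {σ} (u : Term LE (basic s ∷ Γ) σ) W (sub : termLeaves u ⊆ W) →
                         Denotes W σ (purify u W sub) (evalT LE M u (a ∷ γ))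
        purify-correct (var x)          W sub = purifyVar-correct x W sub
        purify-correct (con c)          W sub = refl
        purify-correct (app (inj₁ f) u) W sub = cong (fun (inj₁ f)) (purify-correct u W sub)
        purify-correct (app (inj₂ i) u) W sub =
          trans (leafValues-leafVar (sub (here refl))) (cong (fun (inj₂ i)) (artVar-eval u))

        Holds : ∀ W → Clause W → Set
        Holds W ((A , _) , B) = sat LE M A γ × sat LS R B (a ∷ leafValues W)

        pureClause-holds : ∀ {W} (B : Fm LS (s ∷ leafSorts W)) →
                           Any (Holds W) (pureClause B ∷ []) ⇔ sat LS R B (a ∷ leafValues W)
        pureClause-holds B = mk⇔ (λ h → proj₂ (singleton⁻ h)) (λ b → here (tt , b))

        artClause-holds : ∀ {W} (A : Σ (Fm LE Γ) (IsQF LE)) →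
                          Any (Holds W) (artClause A ∷ []) ⇔ sat LE M (proj₁ A) γ
        artClause-holds A = mk⇔ (λ h → proj₁ (singleton⁻ h)) (λ h → here (h , tt))

        ∧ᶜ-holds : ∀ {W} (c d : Clause W) → Holds W (c ∧ᶜ d) ⇔ (Holds W c × Holds W d)
        ∧ᶜ-holds ((A , _) , B) ((A′ , _) , B′) =
          mk⇔ (λ ((x , x′) , (y , y′)) → (x , y) , (x′ , y′))
              (λ ((x , y) , (x′ , y′)) → (x , x′) , (y , y′))

        ⋀-holds : ∀ {W} (cs ds : List (Clause W)) →
                  Any (Holds W) (cs ⋀ ds) ⇔ (Any (Holds W) cs × Any (Holds W) ds)
        ⋀-holds cs ds =
          mk⇔ (cartesianProductWith⁻ _∧ᶜ_ (λ {c} {d} → Equivalence.to (∧ᶜ-holds c d)) cs ds)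
              (λ (hc , hd) → cartesianProductWith⁺ _∧ᶜ_
                 (λ {c} {d} x y → Equivalence.from (∧ᶜ-holds c d) (x , y)) hc hd)

        dnf⁺-correct : ∀ {φ} (q : IsQF LE φ) W (sub : fmLeaves q ⊆ W) →
                       sat LE M φ (a ∷ γ) ⇔ Any (Holds W) (dnf⁺ q W sub)
        dnf⁻-correct : ∀ {φ} (q : IsQF LE φ) W (sub : fmLeaves q ⊆ W) →
                       (¬ sat LE M φ (a ∷ γ)) ⇔ Any (Holds W) (dnf⁻ q W sub)
        dnf⁺-correct (qf-eq {basic t} u v) W sub = ⇔-trans
          (≡-cong⇔ (sym (purify-correct u W (⊆-left sub))) (sym (purify-correct v W (⊆-right sub))))
          (⇔-sym (pureClause-holds _))
        dnf⁺-correct (qf-eq {art k} u v) W sub = ⇔-trans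
          (≡-cong⇔ (sym (artVar-eval u)) (sym (artVar-eval v))) (⇔-sym (artClause-holds _))
        dnf⁺-correct qf-tt W sub = ⇔-sym (pureClause-holds tt)
        dnf⁺-correct qf-ff W sub = mk⇔ (λ ()) (λ ())
        dnf⁺-correct (qf-not q) W sub = dnf⁻-correct q W sub
        dnf⁺-correct (qf-and q q′) W sub = ⇔-trans
          (dnf⁺-correct q W (⊆-left sub) ×-cong dnf⁺-correct q′ W (⊆-right sub))
          (⇔-sym (⋀-holds _ _))
        dnf⁺-correct (qf-or q q′) W sub = ⇔-trans
          (dnf⁺-correct q W (⊆-left sub) ⊎-cong dnf⁺-correct q′ W (⊆-right sub))
          (↔⇒⇔ ++↔)
        dnf⁻-correct (qf-eq {basic t} u v) W sub = ⇔-trans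
          (¬-cong-⇔ (≡-cong⇔ (sym (purify-correct u W (⊆-left sub)))
                             (sym (purify-correct v W (⊆-right sub)))))
          (⇔-sym (pureClause-holds _))
        dnf⁻-correct (qf-eq {art k} u v) W sub = ⇔-trans
          (¬-cong-⇔ (≡-cong⇔ (sym (artVar-eval u)) (sym (artVar-eval v))))
          (⇔-sym (artClause-holds _))
        dnf⁻-correct qf-tt W sub = mk⇔ (λ ¬⊤ → ⊥-elim (¬⊤ tt)) (λ ())
        dnf⁻-correct qf-ff W sub = mk⇔ (λ _ → here (tt , tt)) (λ _ ())
        dnf⁻-correct (qf-not q) W sub =
          ⇔-trans (mk⇔ (em⇒dne em) (λ p ¬p → ¬p p)) (dnf⁺-correct q W sub)
        dnf⁻-correct (qf-and q q′) W sub = ⇔-trans (¬×⇔¬⊎¬ em) (⇔-trans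
          (dnf⁻-correct q W (⊆-left sub) ⊎-cong dnf⁻-correct q′ W (⊆-right sub))
          (↔⇒⇔ ++↔))
        dnf⁻-correct (qf-or q q′) W sub = ⇔-trans ¬⊎⇔¬×¬ (⇔-trans
          (dnf⁻-correct q W (⊆-left sub) ×-cong dnf⁻-correct q′ W (⊆-right sub))
          (⇔-sym (⋀-holds _ _)))

      open AtValue using (Holds)

      -- ∃x (A ∧ B(x)) ↔ A ∧ ∃x B(x), and ∃x B is equivalent in T* to its
      -- quantifier-free form.
      solved-sat : _⊨_ LS R T* → ∀ W (c : Clause W) →
                   sat LE M (solved W c) γ ⇔ Σ (carrier (basic s)) λ a → Holds a W c
      solved-sat good W ((A , qA) , B) = begin
        (sat LE M A γ × sat LE M (unpurifyF W qθ) γ)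
          ∼⟨ ⇔-id _ ×-cong unpurifyF-sat W qθ ⟩
        (sat LE M A γ × sat LS R θ (leafValues W))
          ∼⟨ ⇔-id _ ×-cong ⇔-sym (proj₂ (proj₂ (qe (∃' s B))) R good (leafValues W)) ⟩
        (sat LE M A γ × Σ (carrier (basic s)) (λ a → sat LS R B (a ∷ leafValues W)))
          ∼⟨ ×-∃⇔∃-× ⟩
        Σ (carrier (basic s)) (λ a → Holds a W ((A , qA) , B)) ∎
        where
        θ : Fm LS (leafSorts W)
        θ = proj₁ (solvedQE W B)
        qθ : IsQF LS θ
        qθ = proj₂ (solvedQE W B)

      eliminated-sat : _⊨_ LS R T* → ∀ W (cs : List (Clause W)) →
                       sat LE M (eliminated W cs) γ ⇔ Σ (carrier (basic s)) λ a → Any (Holds a W) cs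
      eliminated-sat good W cs = begin
        sat LE M (⋁ (map (solved W) cs)) γ   ∼⟨ ⋁-sat M _ γ ⟩
        Any (λ φ → sat LE M φ γ) (map (solved W) cs)   ↔⟨ map↔ ⟨
        Any (λ c → sat LE M (solved W c) γ) cs         ∼⟨ Any-cong (solved-sat good W) ⟩
        Any (λ c → Σ (carrier (basic s)) λ a → Holds a W c) cs   ∼⟨ ⇔-sym (∃-Any cs) ⟩
        Σ (carrier (basic s)) (λ a → Any (Holds a W) cs) ∎

    eliminate : ∀ {φ} → IsQF LE φ → Σ (Fm LE Γ) λ ψ → IsQF LE ψ × (∃' (basic s) φ ≋ ψ)
    eliminate {φ} q = eliminated W cs , eliminated-QF W cs , λ M good γ →
      let open AtStructure M γ in ⇔-trans
        (∃-cong λ a → AtValue.dnf⁺-correct a q W (λ p → p))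
        (⇔-sym (eliminated-sat good W cs))
      where
      W : List Leaf
      W = fmLeaves q
      cs : List (Clause W)
      cs = dnf⁺ q W (λ p → p)

  -- A state formula over an arbitrary context Δ.
  record Prenex (Δ : Ctx LE) : Set where
    field
      arts     : List (Fin nA)
      matrix   : Fm LE (map art arts ++ Δ)
      matrixQF : IsQF LE matrix

  ⟦_⟧ : ∀ {Δ} → Prenex Δ → Fm LE Δ
  ⟦ ψ ⟧ = exs LE (map art arts) matrix
    where open Prenex ψ

  -- Quantifying a state formula gives a state formula: an artifact variable
  -- joins the block, a basic one is moved inside the block and eliminated.
  ∃-prenex : ∀ σ {Δ} (ψ : Prenex (σ ∷ Δ)) → Σ (Prenex Δ) λ ψ′ → ∃' σ ⟦ ψ ⟧ ≋ ⟦ ψ′ ⟧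
  ∃-prenex (art k) ψ =
    record { arts = k ∷ arts ; matrix = renameF (moveFront (map art arts)) matrix
           ; matrixQF = renameF-QF _ matrixQF } ,
    λ M _ ρ → ∃-over-exs M (map art arts) matrix ρ
    where open Prenex ψ
  ∃-prenex (basic s) {Δ} ψ =
    record { arts = arts ; matrix = proj₁ elim ; matrixQF = proj₁ (proj₂ elim) } ,
    λ M good ρ → ⇔-trans (∃-over-exs M (map art arts) matrix ρ)
                         (exs-cong M (map art arts) (proj₂ (proj₂ elim) M good) ρ)
    where
    open Prenex ψ
    elim : Σ (Fm LE (map art arts ++ Δ)) λ θ → IsQF LE θ ×
           (∃' (basic s) (renameF (moveFront (map art arts)) matrix) ≋ θ)
    elim = Elimination.eliminate (map art arts ++ Δ) s
             (renameF-QF (moveFront (map art arts)) matrixQF)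

  exs-prenex : ∀ (E : Ctx LE) {Δ} (ψ : Prenex (E ++ Δ)) → Σ (Prenex Δ) λ ψ′ → exs LE E ⟦ ψ ⟧ ≋ ⟦ ψ′ ⟧
  exs-prenex []      ψ = ψ , λ M _ ρ → ⇔-id _
  exs-prenex (σ ∷ E) ψ =
    let (ψ₁ , eq₁) = ∃-prenex σ ψ
        (ψ₂ , eq₂) = exs-prenex E ψ₁
    in ψ₂ , λ M good ρ → ⇔-trans (exs-cong M E (eq₁ M good) ρ) (eq₂ M good ρ)

lemmaD2 : ExcludedMiddle 0ℓ →
    (Sg : DBSig) (T T* : Theory (sigLang Sg)) →
    IsDBTheory Sg T →
    IsModelCompletion (sigLang Sg) T T* →
    (nA : ℕ) (S : ArtSetting Sg nA) (φ : ExtStateFm S) →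
    Σ (StateFm S) λ ψ →
    (M : Structure (extLang S)) → _⊨_ (sigLang Sg) (reduct S M) T* →
    (ρ : Env (extLang S) M (xCtx S)) →
    sat (extLang S) M (extStateFm S φ) ρ ⇔ sat (extLang S) M (stateFm S ψ) ρ
lemmaD2 em Sg T T* _ mc nA S φ =
  -- read the extended state formula as an empty artifact block under its
  -- quantifier prefix, and absorb the prefix into the block
  let (ψ , equiv) = exs-prenex evars (record { arts = [] ; matrix = body ; matrixQF = bodyQF })
      open Prenex ψ
  in record { evars = arts ; body = matrix ; bodyQF = matrixQF } , equiv
  where
  open ArtifactQE em T* (IsModelCompletion.qe mc) S
  open ExtStateFm φ
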